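{- Let $S$ be a finite set of Boolean state variables, let $I(S)$ be a propositional formula specifying the initial states and $T(S,S')$ a propositional formula specifying the transition relation of a transition system, and assume the system has the stuttering feature: $T(\mathbf{s},\mathbf{s})=1$ for every state $\mathbf{s}$. Let $n\ge 0$. Then $\mathrm{Di}(I,T)\le n$ if and only if $$\exists S_0\cup\dots\cup S_n\,\big[I_0\wedge T_{0,1}\wedge\dots\wedge T_{n,n+1}\big]\;\equiv\;\exists S_0\cup\dots\cup S_n\,\big[I_0\wedge I_1\wedge T_{0,1}\wedge\dots\wedge T_{n,n+1}\big]$$ as formulas in the free variables $S_{n+1}$ (i.e. iff $I_1$ is redundant in the second quantified formula).
   Context: A state is an assignment to $S$. $S_j$ denotes a copy of the state variables for time frame $j$; $I_0=I(S_0)$, $I_1=I(S_1)$, and $T_{j,j+1}=T(S_j,S_{j+1})$. A trace $\mathbf{s}_0,\dots,\mathbf{s}_k$ is valid if $I(\mathbf{s}_0)=1$ and $T(\mathbf{s}_i,\mathbf{s}_{i+1})=1$ for $i=0,\dots,k-1$; then $\mathbf{s}_k$ is reachable in $k$ transitions. The reachability diameter $\mathrm{Di}(I,T)$ is the least $m$ such that every reachable state is reachable in at most $m$ transitions; so $\mathrm{Di}(I,T)\le n$ means every reachable state is reachable in at most $n$ transitions. A formula $A$ is redundant in $\exists X\,[A\wedge B]$ if $\exists X\,[A\wedge B]\equiv\exists X\,[B]$. -}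

module Defs where

open import Data.Nat using (ℕ; zero; suc; _≤_)
open import Data.Bool using (Bool; true)
open import Data.Fin using (Fin; zero; suc; inject₁; fromℕ)
open import Data.Vec using (Vec)
open import Data.Product using (Σ; ∃; _×_)
open import Relation.Binary.PropositionalEquality using (_≡_)
open import Function.Bundles using (_⇔_)

State : ℕ → Set
State m = Vec Bool m

-- Semantics of propositional formulas I(S) and T(S,S') as Boolean functions.
InitPred : ℕ → Set
InitPred m = State m → Bool

TransRel : ℕ → Set
TransRel m = State m → State m → Bool

Stuttering : ∀ {m} → TransRel m → Set
Stuttering {m} T = (s : State m) → T s s ≡ true

ValidTrace : ∀ {m} → InitPred m → TransRel m → (k : ℕ) → (Fin (suc k) → State m) → Set
ValidTrace I T k tr =
  I (tr zero) ≡ true × ((i : Fin k) → T (tr (inject₁ i)) (tr (suc i)) ≡ true)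

ReachableIn : ∀ {m} → InitPred m → TransRel m → ℕ → State m → Set
ReachableIn {m} I T k s =
  Σ (Fin (suc k) → State m) λ tr → ValidTrace I T k tr × tr (fromℕ k) ≡ s

Reachable : ∀ {m} → InitPred m → TransRel m → State m → Set
Reachable I T s = ∃ λ k → ReachableIn I T k s

DiameterAtMost : ∀ {m} → InitPred m → TransRel m → ℕ → Set
DiameterAtMost {m} I T n =
  (s : State m) → Reachable I T s → ∃ λ k → k ≤ n × ReachableIn I T k s

-- Semantics of  ∃ S_0 ∪ ... ∪ S_n [ I_0 ∧ T_{0,1} ∧ ... ∧ T_{n,n+1} ]
-- evaluated at the free variables S_{n+1} := s.  The copies S_0..S_{n+1}
-- are the entries tr 0 .. tr (n+1); tr (n+1) is pinned to s.
Unroll : ∀ {m} → InitPred m → TransRel m → (n : ℕ) → State m → Set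
Unroll {m} I T n s =
  Σ (Fin (suc (suc n)) → State m) λ tr →
    tr (fromℕ (suc n)) ≡ s ×
    (I (tr zero) ≡ true ×
     ((i : Fin (suc n)) → T (tr (inject₁ i)) (tr (suc i)) ≡ true))

-- Semantics of  ∃ S_0 ∪ ... ∪ S_n [ I_0 ∧ I_1 ∧ T_{0,1} ∧ ... ∧ T_{n,n+1} ]
-- at S_{n+1} := s.
UnrollI1 : ∀ {m} → InitPred m → TransRel m → (n : ℕ) → State m → Set
UnrollI1 {m} I T n s =
  Σ (Fin (suc (suc n)) → State m) λ tr →
    tr (fromℕ (suc n)) ≡ s ×
    (I (tr zero) ≡ true × I (tr (suc zero)) ≡ true ×
     ((i : Fin (suc n)) → T (tr (inject₁ i)) (tr (suc i)) ≡ true))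

I1Redundant : ∀ {m} → InitPred m → TransRel m → ℕ → Set
I1Redundant {m} I T n = (s : State m) → Unroll I T n s ⇔ UnrollI1 I T n s

-- With stuttering, the states reachable in exactly k steps form an increasing
-- chain R₀ ⊆ R₁ ⊆ …, and the quantified formulas denote R_{n+1} (without I₁)
-- and R_n (with I₁, after dropping the stuttering first step).  Redundancy of
-- I₁ is therefore R_{n+1} ⊆ R_n; since R_{k+1} depends only on R_k, this
-- propagates to R_k ⊆ R_n for every k ≥ n, which is exactly Di(I,T) ≤ n.
module Submission where

open import Defs
open import Data.Nat using (ℕ; zero; suc; _≤′_; ≤′-refl; ≤′-step)
open import Data.Nat.Properties using (≤-refl; ≤-total; ≤⇒≤′)
open import Data.Bool using (true)
open import Data.Fin using (Fin; zero; suc; inject₁; fromℕ)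
open import Data.Vec.Functional using (Vector; _∷_; head; tail; init; last)
open import Data.Product using (_,_)
open import Data.Sum using (inj₁; inj₂)
open import Level using (Level)
open import Relation.Binary.PropositionalEquality using (_≡_; refl)
open import Relation.Unary using (_⊆_)
open import Function using (id; _∘_)
open import Function.Bundles using (_⇔_; mk⇔; Equivalence)
import Function.Properties.Equivalence as ⇔

module _ {a : Level} {A : Set a} where

  _∷ʳ_ : ∀ {k} → Vector A (suc k) → A → Vector A (suc (suc k))
  (u ∷ʳ s) zero = u zero
  (_∷ʳ_ {zero}  u s) (suc zero) = s
  (_∷ʳ_ {suc k} u s) (suc i) = (tail u ∷ʳ s) i

  last-∷ʳ : ∀ {k} (u : Vector A (suc k)) (s : A) → last (u ∷ʳ s) ≡ s
  last-∷ʳ {zero}  u s = refl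
  last-∷ʳ {suc k} u s = last-∷ʳ (tail u) s

module _ {a ℓ : Level} {A : Set a} (R : A → A → Set ℓ) where

  Chain : ∀ {k} → Vector A (suc k) → Set ℓ
  Chain {k} u = (i : Fin k) → R (u (inject₁ i)) (u (suc i))

  Chain-∷ʳ : ∀ {k} {u : Vector A (suc k)} {s : A} →
             Chain u → R (last u) s → Chain (u ∷ʳ s)
  Chain-∷ʳ {zero}  c e zero = e
  Chain-∷ʳ {suc k} c e zero = c zero
  Chain-∷ʳ {suc k} c e (suc i) = Chain-∷ʳ (c ∘ suc) e i

  Chain-∷ : ∀ {k} {u : Vector A (suc k)} {s : A} →
            R s (head u) → Chain u → Chain (s ∷ u)
  Chain-∷ e c zero = e
  Chain-∷ e c (suc i) = c i

module _ {m : ℕ} (I : InitPred m) (T : TransRel m) where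

  Step : State m → State m → Set
  Step t s = T t s ≡ true

  data Reach : ℕ → State m → Set where
    initial : ∀ {s} → I s ≡ true → Reach zero s
    step    : ∀ {k t s} → Reach k t → Step t s → Reach (suc k) s

  ReachableIn⇒Reach : ∀ k {s} → ReachableIn I T k s → Reach k s
  ReachableIn⇒Reach zero    (tr , (i₀ , _) , refl) = initial i₀
  ReachableIn⇒Reach (suc k) (tr , (i₀ , c) , refl) =
    step (ReachableIn⇒Reach k (init tr , (i₀ , c ∘ inject₁) , refl)) (c (fromℕ k))

  Reach⇒ReachableIn : ∀ {k s} → Reach k s → ReachableIn I T k s
  Reach⇒ReachableIn {s = s} (initial i₀) = (λ _ → s) , (i₀ , λ ()) , refl
  Reach⇒ReachableIn {s = s} (step r e) with Reach⇒ReachableIn r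
  ... | tr , (i₀ , c) , refl = tr ∷ʳ s , (i₀ , Chain-∷ʳ Step c e) , last-∷ʳ tr s

  Reach⇒Reachable : ∀ {k s} → Reach k s → Reachable I T s
  Reach⇒Reachable {k} r = k , Reach⇒ReachableIn r

  Unroll⇔Reach : ∀ n {s} → Unroll I T n s ⇔ Reach (suc n) s
  Unroll⇔Reach n = mk⇔
    (λ (tr , end , i₀ , c) → ReachableIn⇒Reach (suc n) (tr , (i₀ , c) , end))
    (λ r → let tr , (i₀ , c) , end = Reach⇒ReachableIn r in tr , end , i₀ , c)

  Reach-suc-mono : ∀ {k n} → Reach k ⊆ Reach n → Reach (suc k) ⊆ Reach (suc n)
  Reach-suc-mono k⊆n (step r e) = step (k⊆n r) e

  Reach-stable⇒≥⊆ : ∀ {n} → Reach (suc n) ⊆ Reach n → ∀ {k} → n ≤′ k → Reach k ⊆ Reach n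
  Reach-stable⇒≥⊆ stable ≤′-refl       = id
  Reach-stable⇒≥⊆ stable (≤′-step n≤k) = stable ∘ Reach-suc-mono (Reach-stable⇒≥⊆ stable n≤k)

  module _ (stut : Stuttering T) where

    Reach-⊆-suc : ∀ {k} → Reach k ⊆ Reach (suc k)
    Reach-⊆-suc {x = s} r = step r (stut s)

    Reach-mono : ∀ {k n} → k ≤′ n → Reach k ⊆ Reach n
    Reach-mono ≤′-refl       = id
    Reach-mono (≤′-step k≤n) = Reach-⊆-suc ∘ Reach-mono k≤n

    Reach-stable⇒⊆ : ∀ {n} → Reach (suc n) ⊆ Reach n → ∀ k → Reach k ⊆ Reach n
    Reach-stable⇒⊆ {n} stable k with ≤-total k n
    ... | inj₁ k≤n = Reach-mono (≤⇒≤′ k≤n)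
    ... | inj₂ n≤k = Reach-stable⇒≥⊆ stable (≤⇒≤′ n≤k)

    UnrollI1⇔Reach : ∀ n {s} → UnrollI1 I T n s ⇔ Reach n s
    UnrollI1⇔Reach n = mk⇔
      (λ (tr , end , _ , i₁ , c) → ReachableIn⇒Reach n (tail tr , (i₁ , c ∘ suc) , end))
      (λ r → let tr , (i₀ , c) , end = Reach⇒ReachableIn r
             in head tr ∷ tr , end , i₀ , i₀ , Chain-∷ Step (stut (head tr)) c)

    I1Redundant⇔Reach-stable : ∀ n → I1Redundant I T n ⇔ (Reach (suc n) ⊆ Reach n)
    I1Redundant⇔Reach-stable n = mk⇔
      (λ red {s} → to (UnrollI1⇔Reach n) ∘ to (red s) ∘ from (Unroll⇔Reach n))
      (λ stable s → mk⇔
        (λ u → from (UnrollI1⇔Reach n) (stable (to (Unroll⇔Reach n) u)))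
        (λ u → from (Unroll⇔Reach n) (Reach-⊆-suc (to (UnrollI1⇔Reach n) u))))
      where open Equivalence

    DiameterAtMost⇔Reach-stable : ∀ n → DiameterAtMost I T n ⇔ (Reach (suc n) ⊆ Reach n)
    DiameterAtMost⇔Reach-stable n = mk⇔ bounded⇒stable stable⇒bounded
      where
      bounded⇒stable : DiameterAtMost I T n → Reach (suc n) ⊆ Reach n
      bounded⇒stable diam {s} r with diam s (Reach⇒Reachable r)
      ... | k , k≤n , rₖ = Reach-mono (≤⇒≤′ k≤n) (ReachableIn⇒Reach k rₖ)

      stable⇒bounded : Reach (suc n) ⊆ Reach n → DiameterAtMost I T n
      stable⇒bounded stable s (k , rₖ) =
        n , ≤-refl , Reach⇒ReachableIn (Reach-stable⇒⊆ stable k (ReachableIn⇒Reach k rₖ))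

proposition1 : (m : ℕ) (I : InitPred m) (T : TransRel m) →
               Stuttering T → (n : ℕ) →
               DiameterAtMost I T n ⇔ I1Redundant I T n
proposition1 m I T stut n =
  ⇔.trans (DiameterAtMost⇔Reach-stable I T stut n)
          (⇔.sym (I1Redundant⇔Reach-stable I T stut n))
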